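{- Let $\mathscr{A},\mathscr{B}$ be closed sets of impartial games. Suppose that every $G\in\mathscr{A}$ satisfies $G=^- H$ for some $H\in\mathscr{B}$, and every $H\in\mathscr{B}$ satisfies $H=^- G$ for some $G\in\mathscr{A}$. Then $\mathcal{Q}(\mathscr{A})\cong\mathcal{Q}(\mathscr{B})$.
   Context: All games are impartial; $G+H$ is the disjunctive sum. In misère play the last player to move loses; $o^-(G)$ is the misère outcome. $G=^- H$ (misère canonical equality) means $o^-(G+X)=o^-(H+X)$ for every impartial game $X$. A set of games is closed if it is closed under sums and under taking options. For closed $\mathscr{A}$, $G\equiv_{\mathscr{A}}H$ iff $o^-(G+X)=o^-(H+X)$ for all $X\in\mathscr{A}$; the misère quotient $\mathcal{Q}(\mathscr{A})$ is $(\mathscr{A}/\equiv_{\mathscr{A}},\mathcal{P})$ with $\mathcal{P}$ the set of classes of misère $\mathscr{P}$-positions. Isomorphism means a monoid isomorphism $f$ with $x\in\mathcal{P}\iff f(x)\in\mathcal{P}'$. -}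

module Defs where

open import Data.List using (List; []; _∷_; _++_)
open import Data.List.Membership.Propositional using (_∈_)
open import Data.Bool using (Bool; true; false; not; _∧_)
open import Data.Product using (Σ; _×_; _,_; proj₁)
open import Relation.Binary.PropositionalEquality using (_≡_)
open import Function.Bundles using (_⇔_)
open import Level using (Level; _⊔_; suc)

data Game : Set where
  mk : List Game → Game

options : Game → List Game
options (mk gs) = gs

mutual
  _+ᴳ_ : Game → Game → Game
  mk gs +ᴳ mk hs = mk (leftOpts gs hs ++ rightOpts gs hs)

  leftOpts : List Game → List Game → List Game
  leftOpts [] hs = []
  leftOpts (g ∷ gs) hs = (g +ᴳ mk hs) ∷ leftOpts gs hs

  rightOpts : List Game → List Game → List Game
  rightOpts gs [] = []
  rightOpts gs (h ∷ hs) = (mk gs +ᴳ h) ∷ rightOpts gs hs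

infixl 6 _+ᴳ_

-- Misère play: the player unable to move wins (the last player to move loses).
-- isMisereP G = true iff G is a misère P-position (previous player wins):
-- G has at least one option, and every option is a misère N-position.
mutual
  isMisereP : Game → Bool
  isMisereP (mk []) = false
  isMisereP (mk (g ∷ gs)) = allN (g ∷ gs)

  allN : List Game → Bool
  allN [] = true
  allN (g ∷ gs) = not (isMisereP g) ∧ allN gs

data Outcome : Set where
  𝒩 𝒫 : Outcome

o⁻ : Game → Outcome
o⁻ G with isMisereP G
... | true = 𝒫
... | false = 𝒩

_=⁻_ : Game → Game → Set
G =⁻ H = ∀ (X : Game) → o⁻ (G +ᴳ X) ≡ o⁻ (H +ᴳ X)

GameSet : (ℓ : Level) → Set (Level.suc ℓ)
GameSet ℓ = Game → Set ℓ

record Closed {ℓ : Level} (𝒜 : GameSet ℓ) : Set ℓ where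
  field
    sum-closed : ∀ {G H} → 𝒜 G → 𝒜 H → 𝒜 (G +ᴳ H)
    option-closed : ∀ {G G′} → 𝒜 G → G′ ∈ options G → 𝒜 G′

Elem : {ℓ : Level} → GameSet ℓ → Set ℓ
Elem 𝒜 = Σ Game 𝒜

_≡[_]_ : {ℓ : Level} → Game → GameSet ℓ → Game → Set ℓ
G ≡[ 𝒜 ] H = ∀ (X : Game) → 𝒜 X → o⁻ (G +ᴳ X) ≡ o⁻ (H +ᴳ X)

-- The misère quotient 𝒬(𝒜) is presented as the setoid (Elem 𝒜, ≡_𝒜) with the
-- monoid operation induced by +ᴳ and the distinguished subset 𝒫 of classes of
-- misère P-positions.  An isomorphism 𝒬(𝒜) ≅ 𝒬(ℬ) is given by a map on
-- representatives that is well defined on classes, injective and surjective on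
-- classes, preserves sums (hence, being bijective, also the identity), and
-- satisfies  x ∈ 𝒫 ⇔ f x ∈ 𝒫′.
record QuotientIso {ℓ₁ ℓ₂ : Level} (𝒜 : GameSet ℓ₁) (ℬ : GameSet ℓ₂) : Set (ℓ₁ ⊔ ℓ₂) where
  field
    f : Elem 𝒜 → Elem ℬ
    well-defined : ∀ (x y : Elem 𝒜) → proj₁ x ≡[ 𝒜 ] proj₁ y → proj₁ (f x) ≡[ ℬ ] proj₁ (f y)
    injective : ∀ (x y : Elem 𝒜) → proj₁ (f x) ≡[ ℬ ] proj₁ (f y) → proj₁ x ≡[ 𝒜 ] proj₁ y
    surjective : ∀ (z : Elem ℬ) → Σ (Elem 𝒜) (λ x → proj₁ (f x) ≡[ ℬ ] proj₁ z)
    hom : ∀ (x y : Elem 𝒜) (s : 𝒜 (proj₁ x +ᴳ proj₁ y)) →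
          proj₁ (f (proj₁ x +ᴳ proj₁ y , s)) ≡[ ℬ ] (proj₁ (f x) +ᴳ proj₁ (f y))
    preserves-𝒫 : ∀ (x : Elem 𝒜) → (o⁻ (proj₁ x) ≡ 𝒫) ⇔ (o⁻ (proj₁ (f x)) ≡ 𝒫)

_≅𝒬_ : {ℓ₁ ℓ₂ : Level} → GameSet ℓ₁ → GameSet ℓ₂ → Set (ℓ₁ ⊔ ℓ₂)
𝒜 ≅𝒬 ℬ = QuotientIso 𝒜 ℬ

{-# OPTIONS --safe #-}
module Submission where

open import Defs
open import Level using (Level)
open import Data.Product using (Σ; _×_; _,_; proj₁; proj₂)
open import Data.List using ([]; _∷_; _++_; null)
open import Data.List.Properties using (++-assoc)
open import Data.Bool using (true; false; not; _∧_)
open import Data.Bool.Properties using (∧-assoc; ∧-comm)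
open import Relation.Binary.PropositionalEquality
open import Function.Bundles using (mk⇔)

-- Send each G ∈ 𝒜 to some H ∈ ℬ with G =⁻ H.  Every test game of ℬ is =⁻ to one
-- of 𝒜 and vice versa, so two games of 𝒜 are 𝒜-indistinguishable exactly when
-- their images are ℬ-indistinguishable.  Since o⁻ (G + X) is symmetric in G and X
-- and + is associative, =⁻ is a congruence for +, and testing against the empty
-- game shows that it preserves misère outcomes.

leftOpts-++ : ∀ xs ys ks → leftOpts (xs ++ ys) ks ≡ leftOpts xs ks ++ leftOpts ys ks
leftOpts-++ []       ys ks = refl
leftOpts-++ (x ∷ xs) ys ks = cong (_ ∷_) (leftOpts-++ xs ys ks)

rightOpts-++ : ∀ gs xs ys → rightOpts gs (xs ++ ys) ≡ rightOpts gs xs ++ rightOpts gs ys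
rightOpts-++ gs []       ys = refl
rightOpts-++ gs (x ∷ xs) ys = cong (_ ∷_) (rightOpts-++ gs xs ys)

-- The list lemmas take games rather than option lists so that the mutual
-- recursion with +ᴳ-assoc passes the termination checker.
mutual
  +ᴳ-assoc : ∀ G H K → (G +ᴳ H) +ᴳ K ≡ G +ᴳ (H +ᴳ K)
  +ᴳ-assoc (mk gs) (mk hs) (mk ks) = cong mk (begin
      leftOpts (ghL ++ ghR) ks ++ rightOpts (ghL ++ ghR) ks
        ≡⟨ cong (_++ rightOpts (ghL ++ ghR) ks) (leftOpts-++ ghL ghR ks) ⟩
      (leftOpts ghL ks ++ leftOpts ghR ks) ++ rightOpts (ghL ++ ghR) ks
        ≡⟨ ++-assoc (leftOpts ghL ks) _ _ ⟩
      leftOpts ghL ks ++ (leftOpts ghR ks ++ rightOpts (ghL ++ ghR) ks)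
        ≡⟨ cong₂ _++_ (leftOpts-leftOpts gs (mk hs) (mk ks))
                      (cong₂ _++_ (leftOpts-rightOpts (mk gs) hs (mk ks))
                                  (rightOpts-+ᴳ (mk gs) (mk hs) ks)) ⟩
      leftOpts gs (hkL ++ hkR) ++ (rightOpts gs hkL ++ rightOpts gs hkR)
        ≡⟨ cong (leftOpts gs (hkL ++ hkR) ++_) (rightOpts-++ gs hkL hkR) ⟨
      leftOpts gs (hkL ++ hkR) ++ rightOpts gs (hkL ++ hkR) ∎)
    where
    open ≡-Reasoning
    ghL = leftOpts gs hs
    ghR = rightOpts gs hs
    hkL = leftOpts hs ks
    hkR = rightOpts hs ks

  leftOpts-leftOpts : ∀ gs H K →
    leftOpts (leftOpts gs (options H)) (options K) ≡ leftOpts gs (options (H +ᴳ K))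
  leftOpts-leftOpts []       H       K       = refl
  leftOpts-leftOpts (g ∷ gs) (mk hs) (mk ks) =
    cong₂ _∷_ (+ᴳ-assoc g (mk hs) (mk ks)) (leftOpts-leftOpts gs (mk hs) (mk ks))

  leftOpts-rightOpts : ∀ G hs K →
    leftOpts (rightOpts (options G) hs) (options K) ≡ rightOpts (options G) (leftOpts hs (options K))
  leftOpts-rightOpts G       []       K       = refl
  leftOpts-rightOpts (mk gs) (h ∷ hs) (mk ks) =
    cong₂ _∷_ (+ᴳ-assoc (mk gs) h (mk ks)) (leftOpts-rightOpts (mk gs) hs (mk ks))

  rightOpts-+ᴳ : ∀ G H ks →
    rightOpts (options (G +ᴳ H)) ks ≡ rightOpts (options G) (rightOpts (options H) ks)
  rightOpts-+ᴳ G       H       []       = refl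
  rightOpts-+ᴳ (mk gs) (mk hs) (k ∷ ks) =
    cong₂ _∷_ (+ᴳ-assoc (mk gs) (mk hs) k) (rightOpts-+ᴳ (mk gs) (mk hs) ks)

mutual
  +ᴳ-identityʳ : ∀ G → G +ᴳ mk [] ≡ G
  +ᴳ-identityʳ (mk gs) = cong mk (options-+ᴳ-identityʳ gs)

  options-+ᴳ-identityʳ : ∀ gs → leftOpts gs [] ++ rightOpts gs [] ≡ gs
  options-+ᴳ-identityʳ []       = refl
  options-+ᴳ-identityʳ (g ∷ gs) = cong₂ _∷_ (+ᴳ-identityʳ g) (options-+ᴳ-identityʳ gs)

isMisereP-mk : ∀ gs → isMisereP (mk gs) ≡ not (null gs) ∧ allN gs
isMisereP-mk []       = refl
isMisereP-mk (g ∷ gs) = refl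

allN-++ : ∀ xs ys → allN (xs ++ ys) ≡ allN xs ∧ allN ys
allN-++ []       ys = refl
allN-++ (x ∷ xs) ys =
  trans (cong (not (isMisereP x) ∧_) (allN-++ xs ys)) (sym (∧-assoc (not (isMisereP x)) (allN xs) (allN ys)))

null-options-+ᴳ : ∀ gs hs → null (options (mk gs +ᴳ mk hs)) ≡ null gs ∧ null hs
null-options-+ᴳ []       []       = refl
null-options-+ᴳ []       (h ∷ hs) = refl
null-options-+ᴳ (g ∷ gs) hs       = refl

isMisereP-+ᴳ : ∀ gs hs → isMisereP (mk gs +ᴳ mk hs) ≡
  not (null gs ∧ null hs) ∧ (allN (leftOpts gs hs) ∧ allN (rightOpts gs hs))
isMisereP-+ᴳ gs hs = begin
  isMisereP (mk (leftOpts gs hs ++ rightOpts gs hs))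
    ≡⟨ isMisereP-mk (leftOpts gs hs ++ rightOpts gs hs) ⟩
  not (null (leftOpts gs hs ++ rightOpts gs hs)) ∧ allN (leftOpts gs hs ++ rightOpts gs hs)
    ≡⟨ cong₂ (λ e a → not e ∧ a) (null-options-+ᴳ gs hs) (allN-++ (leftOpts gs hs) (rightOpts gs hs)) ⟩
  not (null gs ∧ null hs) ∧ (allN (leftOpts gs hs) ∧ allN (rightOpts gs hs)) ∎
  where open ≡-Reasoning

mutual
  isMisereP-+ᴳ-comm : ∀ G H → isMisereP (G +ᴳ H) ≡ isMisereP (H +ᴳ G)
  isMisereP-+ᴳ-comm (mk gs) (mk hs) = begin
    isMisereP (mk gs +ᴳ mk hs)
      ≡⟨ isMisereP-+ᴳ gs hs ⟩
    not (null gs ∧ null hs) ∧ (allN (leftOpts gs hs) ∧ allN (rightOpts gs hs))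
      ≡⟨ cong₂ (λ e a → not e ∧ a) (∧-comm (null gs) (null hs))
               (cong₂ _∧_ (allN-leftOpts≡allN-rightOpts gs (mk hs))
                          (sym (allN-leftOpts≡allN-rightOpts hs (mk gs)))) ⟩
    not (null hs ∧ null gs) ∧ (allN (rightOpts hs gs) ∧ allN (leftOpts hs gs))
      ≡⟨ cong (not (null hs ∧ null gs) ∧_) (∧-comm (allN (rightOpts hs gs)) (allN (leftOpts hs gs))) ⟩
    not (null hs ∧ null gs) ∧ (allN (leftOpts hs gs) ∧ allN (rightOpts hs gs))
      ≡⟨ isMisereP-+ᴳ hs gs ⟨
    isMisereP (mk hs +ᴳ mk gs) ∎
    where open ≡-Reasoning

  allN-leftOpts≡allN-rightOpts : ∀ gs H → allN (leftOpts gs (options H)) ≡ allN (rightOpts (options H) gs)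
  allN-leftOpts≡allN-rightOpts []       H       = refl
  allN-leftOpts≡allN-rightOpts (g ∷ gs) (mk hs) =
    cong₂ (λ p a → not p ∧ a) (isMisereP-+ᴳ-comm g (mk hs)) (allN-leftOpts≡allN-rightOpts gs (mk hs))

o⁻-+ᴳ-comm : ∀ G H → o⁻ (G +ᴳ H) ≡ o⁻ (H +ᴳ G)
o⁻-+ᴳ-comm G H with isMisereP (G +ᴳ H) | isMisereP (H +ᴳ G) | isMisereP-+ᴳ-comm G H
... | true  | true  | refl = refl
... | false | false | refl = refl

o⁻-+ᴳ-rotate : ∀ G H X → o⁻ ((G +ᴳ H) +ᴳ X) ≡ o⁻ (H +ᴳ (X +ᴳ G))
o⁻-+ᴳ-rotate G H X = begin
  o⁻ ((G +ᴳ H) +ᴳ X)   ≡⟨ cong o⁻ (+ᴳ-assoc G H X) ⟩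
  o⁻ (G +ᴳ (H +ᴳ X))   ≡⟨ o⁻-+ᴳ-comm G (H +ᴳ X) ⟩
  o⁻ ((H +ᴳ X) +ᴳ G)   ≡⟨ cong o⁻ (+ᴳ-assoc H X G) ⟩
  o⁻ (H +ᴳ (X +ᴳ G))   ∎
  where open ≡-Reasoning

-- A proof of G =⁻ H unfolds to a function into equations between misère
-- outcomes, from which Agda cannot recover G and H; lemmas consuming such
-- proofs therefore take the games explicitly.

=⁻⇒o⁻-≡ : ∀ G H → G =⁻ H → o⁻ G ≡ o⁻ H
=⁻⇒o⁻-≡ G H G=H = begin
  o⁻ G             ≡⟨ cong o⁻ (+ᴳ-identityʳ G) ⟨
  o⁻ (G +ᴳ mk [])  ≡⟨ G=H (mk []) ⟩
  o⁻ (H +ᴳ mk [])  ≡⟨ cong o⁻ (+ᴳ-identityʳ H) ⟩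
  o⁻ H             ∎
  where open ≡-Reasoning

=⁻-testˡ : ∀ G H → G =⁻ H → ∀ X → o⁻ (X +ᴳ G) ≡ o⁻ (X +ᴳ H)
=⁻-testˡ G H G=H X = trans (o⁻-+ᴳ-comm X G) (trans (G=H X) (o⁻-+ᴳ-comm H X))

+ᴳ-cong : ∀ G G′ H H′ → G =⁻ G′ → H =⁻ H′ → (G +ᴳ H) =⁻ (G′ +ᴳ H′)
+ᴳ-cong G G′ H H′ G=G′ H=H′ X = begin
  o⁻ ((G +ᴳ H) +ᴳ X)     ≡⟨ cong o⁻ (+ᴳ-assoc G H X) ⟩
  o⁻ (G +ᴳ (H +ᴳ X))     ≡⟨ G=G′ (H +ᴳ X) ⟩
  o⁻ (G′ +ᴳ (H +ᴳ X))    ≡⟨ cong o⁻ (+ᴳ-assoc G′ H X) ⟨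
  o⁻ ((G′ +ᴳ H) +ᴳ X)    ≡⟨ o⁻-+ᴳ-rotate G′ H X ⟩
  o⁻ (H +ᴳ (X +ᴳ G′))    ≡⟨ H=H′ (X +ᴳ G′) ⟩
  o⁻ (H′ +ᴳ (X +ᴳ G′))   ≡⟨ o⁻-+ᴳ-rotate G′ H′ X ⟨
  o⁻ ((G′ +ᴳ H′) +ᴳ X)   ∎
  where open ≡-Reasoning

≡[]-transport : ∀ {ℓ₁ ℓ₂} {𝒜 : GameSet ℓ₁} {ℬ : GameSet ℓ₂} →
  (∀ X → ℬ X → Σ Game (λ X′ → 𝒜 X′ × (X =⁻ X′))) →
  ∀ G G′ H H′ → G =⁻ G′ → H =⁻ H′ → G ≡[ 𝒜 ] H → G′ ≡[ ℬ ] H′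
≡[]-transport ℬ⊆𝒜 G G′ H H′ G=G′ H=H′ G≡H X X∈ℬ with ℬ⊆𝒜 X X∈ℬ
... | X′ , X′∈𝒜 , X=X′ = begin
  o⁻ (G′ +ᴳ X)   ≡⟨ G=G′ X ⟨
  o⁻ (G +ᴳ X)    ≡⟨ =⁻-testˡ X X′ X=X′ G ⟩
  o⁻ (G +ᴳ X′)   ≡⟨ G≡H X′ X′∈𝒜 ⟩
  o⁻ (H +ᴳ X′)   ≡⟨ =⁻-testˡ X X′ X=X′ H ⟨
  o⁻ (H +ᴳ X)    ≡⟨ H=H′ X ⟩
  o⁻ (H′ +ᴳ X)   ∎
  where open ≡-Reasoning

lemma4p7 : {ℓ₁ ℓ₂ : Level} (𝒜 : GameSet ℓ₁) (ℬ : GameSet ℓ₂) →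
    Closed 𝒜 → Closed ℬ →
    (∀ (G : Game) → 𝒜 G → Σ Game (λ H → ℬ H × (G =⁻ H))) →
    (∀ (H : Game) → ℬ H → Σ Game (λ G → 𝒜 G × (H =⁻ G))) →
    𝒜 ≅𝒬 ℬ
lemma4p7 𝒜 ℬ _ _ 𝒜⊆ℬ ℬ⊆𝒜 = record
  { f            = rep
  ; well-defined = λ (G , G∈𝒜) (H , H∈𝒜) →
      ≡[]-transport ℬ⊆𝒜 G (F G∈𝒜) H (F H∈𝒜) (G=F G∈𝒜) (G=F H∈𝒜)
  ; injective    = λ (G , G∈𝒜) (H , H∈𝒜) →
      ≡[]-transport 𝒜⊆ℬ (F G∈𝒜) G (F H∈𝒜) H (F=G G∈𝒜) (F=G H∈𝒜)
  ; surjective   = surjective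
  ; hom          = λ (G , G∈𝒜) (H , H∈𝒜) G+H∈𝒜 X _ →
      trans (F=G G+H∈𝒜 X) (+ᴳ-cong G (F G∈𝒜) H (F H∈𝒜) (G=F G∈𝒜) (G=F H∈𝒜) X)
  ; preserves-𝒫  = λ (G , G∈𝒜) → let o⁻G≡o⁻FG = =⁻⇒o⁻-≡ G (F G∈𝒜) (G=F G∈𝒜) in
      mk⇔ (trans (sym o⁻G≡o⁻FG)) (trans o⁻G≡o⁻FG)
  }
  where
  F : ∀ {G} → 𝒜 G → Game
  F {G} G∈𝒜 = proj₁ (𝒜⊆ℬ G G∈𝒜)

  rep : Elem 𝒜 → Elem ℬ
  rep (G , G∈𝒜) = F G∈𝒜 , proj₁ (proj₂ (𝒜⊆ℬ G G∈𝒜))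

  G=F : ∀ {G} (G∈𝒜 : 𝒜 G) → G =⁻ F G∈𝒜
  G=F {G} G∈𝒜 = proj₂ (proj₂ (𝒜⊆ℬ G G∈𝒜))

  F=G : ∀ {G} (G∈𝒜 : 𝒜 G) → F G∈𝒜 =⁻ G
  F=G G∈𝒜 X = sym (G=F G∈𝒜 X)

  surjective : ∀ (z : Elem ℬ) → Σ (Elem 𝒜) (λ x → proj₁ (rep x) ≡[ ℬ ] proj₁ z)
  surjective (H , H∈ℬ) with ℬ⊆𝒜 H H∈ℬ
  ... | G , G∈𝒜 , H=G = (G , G∈𝒜) , λ X _ → trans (F=G G∈𝒜 X) (sym (H=G X))
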